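{- Let $m$ be an even positive integer and let $N=\lceil\sqrt{m}\,\rceil$. Then $O\chi(D_m)=N$ if and only if $m<N^2-1$.
   Context: For even $m$, $D_m$ denotes the double star on $m$ vertices: the tree obtained from two copies of the star $K_{1,\frac{m}{2}-1}$ by adding an edge joining their two centres (roots). Two proper vertex colourings $c_1,c_2$ of a graph are orthogonal if whenever two distinct vertices receive the same colour in one colouring, they receive different colours in the other (equivalently, $v\mapsto (c_1(v),c_2(v))$ is injective). The orthogonal chromatic number $O\chi(G)$ is the minimum number $c$ such that $G$ has a pair of orthogonal proper vertex colourings each using at most $c$ colours. -}

module Defs where

open import Data.Nat using (ℕ; zero; suc; _*_; _≤_)
open import Data.Fin using (Fin; zero; suc)
open import Data.Sum using (_⊎_; inj₁; inj₂)
open import Data.Product using (Σ; _×_; ∃-syntax)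
open import Relation.Binary.PropositionalEquality using (_≡_; _≢_)

record Graph : Set₁ where
  field
    V   : Set
    Adj : V → V → Set
open Graph public

-- Double star D_m with m = 2 * (suc k): two copies of the star K_{1,k}
-- (vertex set Fin (suc k), centre = zero, leaves = suc i), plus an edge
-- joining the two centres.
data DSAdj (k : ℕ) : (Fin (suc k) ⊎ Fin (suc k)) → (Fin (suc k) ⊎ Fin (suc k)) → Set where
  cl-left  : (i : Fin k) → DSAdj k (inj₁ zero) (inj₁ (suc i))
  lc-left  : (i : Fin k) → DSAdj k (inj₁ (suc i)) (inj₁ zero)
  cl-right : (i : Fin k) → DSAdj k (inj₂ zero) (inj₂ (suc i))
  lc-right : (i : Fin k) → DSAdj k (inj₂ (suc i)) (inj₂ zero)
  bridge₁  : DSAdj k (inj₁ zero) (inj₂ zero)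
  bridge₂  : DSAdj k (inj₂ zero) (inj₁ zero)

DoubleStar : ℕ → Graph
DoubleStar k = record { V = Fin (suc k) ⊎ Fin (suc k) ; Adj = DSAdj k }

IsProper : (G : Graph) {c : ℕ} → (V G → Fin c) → Set
IsProper G col = ∀ u v → Adj G u v → col u ≢ col v

Orthogonal : (G : Graph) {c : ℕ} → (V G → Fin c) → (V G → Fin c) → Set
Orthogonal G c₁ c₂ = ∀ u v → c₁ u ≡ c₁ v → c₂ u ≡ c₂ v → u ≡ v

HasOrthPair : Graph → ℕ → Set
HasOrthPair G c = Σ (V G → Fin c) λ c₁ → Σ (V G → Fin c) λ c₂ →
  IsProper G c₁ × IsProper G c₂ × Orthogonal G c₁ c₂

OChiIs : Graph → ℕ → Set
OChiIs G n = HasOrthPair G n × (∀ c → HasOrthPair G c → n ≤ c)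

IsCeilSqrt : ℕ → ℕ → Set
IsCeilSqrt m N = m ≤ N * N × (∀ k → m ≤ k * k → N ≤ k)

module Submission where

open import Defs
open import Data.Nat using (ℕ; suc; _*_; _∸_; _<_)
open import Relation.Binary.PropositionalEquality using (_≡_)
open import Function.Bundles using (_⇔_)

open import Data.Nat using (zero; _+_; _≤_; s≤s; s≤s⁻¹)
open import Data.Nat.Properties
  using (≤-trans; <-irrefl; n<1+n; m≤n+m; m≤m+n; +-suc; +-monoʳ-≤; +-mono-≤;
         +-cancelˡ-≤; *-cancelˡ-≤; +-identityʳ; m∸n+n≡m; module ≤-Reasoning)
open import Data.Nat.Tactic.RingSolver using (solve-∀)
open import Data.Fin using (Fin; zero; suc; toℕ; splitAt; remQuot; inject≤; opposite; _↑ʳ_)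
open import Data.Fin.Properties
  using (injective⇒≤; +↔⊎; *↔×; inject≤-injective; toℕ-inject≤; toℕ-↑ʳ; toℕ<n;
         splitAt⁻¹-↑ʳ; opposite-prop; opposite-involutive)
open import Data.Sum using (_⊎_; inj₁; inj₂; map₂)
open import Data.Sum.Properties using (inj₂-injective)
open import Data.Sum.Function.Propositional using (_⊎-↔_)
open import Data.Product using (_×_; _,_; proj₁; proj₂; ∃-syntax)
open import Data.Empty using (⊥-elim)
open import Function using (_∘_; Injective; Inverse; Injection; _↔_; Equivalence; mk⇔; mk↔ₛ′)
open import Function.Properties.Inverse using (↔-refl; ↔-sym; ↔-trans; Inverse⇒Injection)
open import Relation.Binary.PropositionalEquality using (_≢_; refl; sym; cong; cong₂; subst; subst₂; module ≡-Reasoning)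

-- A pair of colourings (c₁, c₂) with c colours places each vertex v in the cell
-- (c₁ v, c₂ v) of a c × c grid; the pair is orthogonal iff the placement is
-- injective, and both colourings are proper iff adjacent vertices are placed in
-- different rows and different columns.
--
-- If L and R are the two centres, no vertex is placed in the cells
-- (c₁ L, c₂ R) and (c₁ R, c₂ L), and these cells differ; hence m + 2 ≤ c².  For
-- c = N this is the condition m + 2 ≤ N², and since m ≤ c² it also shows that no
-- orthogonal pair uses fewer than N colours.
--
-- Write N = M + 2, put L in cell (0,0) and R in cell (1,1).  A left
-- leaf may go to any cell with no coordinate 0, a right leaf to any cell with no
-- coordinate 1: each side has 2M private cells (in row/column 1, resp. 0) and the
-- M² cells of {2..M+1}² are shared.  A packing lemma fills the private cells first
-- and the shared cells from opposite ends; the two sides never collide as long as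
-- 2k ≤ 4M + M², which is exactly m + 2 ≤ N².

↔-injective : ∀ {A B : Set} (e : A ↔ B) → Injective _≡_ _≡_ (Inverse.to e)
↔-injective e = Injection.injective (Inverse⇒Injection e)

injection⇒≤ : ∀ {A B : Set} {a b : ℕ} → A ↔ Fin a → B ↔ Fin b →
  (f : A → B) → Injective _≡_ _≡_ f → a ≤ b
injection⇒≤ A≅ B≅ f f-injective =
  injective⇒≤ {f = Inverse.to B≅ ∘ f ∘ Inverse.from A≅}
    (↔-injective (↔-sym A≅) ∘ f-injective ∘ ↔-injective B≅)

Cell : ℕ → Set
Cell c = Fin c × Fin c

Separated : ∀ {c} → Cell c → Cell c → Set
Separated a b = proj₁ a ≢ proj₁ b × proj₂ a ≢ proj₂ b

Separated-sym : ∀ {c} {a b : Cell c} → Separated a b → Separated b a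
Separated-sym (≢₁ , ≢₂) = ≢₁ ∘ sym , ≢₂ ∘ sym

Separated⇒≢ : ∀ {c} {a b : Cell c} → Separated a b → a ≢ b
Separated⇒≢ (≢₁ , _) = ≢₁ ∘ cong proj₁

placement⇒orthogonalPair : ∀ (G : Graph) {c} (cell : V G → Cell c) →
  Injective _≡_ _≡_ cell → (∀ u v → Adj G u v → Separated (cell u) (cell v)) →
  HasOrthPair G c
placement⇒orthogonalPair G cell cell-injective separated =
  proj₁ ∘ cell , proj₂ ∘ cell ,
  (λ u v adj → proj₁ (separated u v adj)) ,
  (λ u v adj → proj₂ (separated u v adj)) ,
  λ u v same₁ same₂ → cell-injective (cong₂ _,_ same₁ same₂)

orthogonalPair⇒room : ∀ {k c} → HasOrthPair (DoubleStar k) c → 2 + 2 * suc k ≤ c * c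
orthogonalPair⇒room {k} {c} (c₁ , c₂ , proper₁ , proper₂ , orthogonal) =
  subst (_≤ c * c) size (injection⇒≤ domain≅ (↔-sym *↔×) extended extended-injective)
  where
  L R : Fin (suc k) ⊎ Fin (suc k)
  L = inj₁ zero
  R = inj₂ zero

  cellOf : Fin (suc k) ⊎ Fin (suc k) → Cell c
  cellOf v = c₁ v , c₂ v

  -- A vertex in cell (c₁ L, c₂ R) would clash with L in row or with R in column.
  emptyˡ : ∀ v → (c₁ L , c₂ R) ≢ cellOf v
  emptyˡ (inj₁ zero)    e = proper₂ L R bridge₁ (sym (cong proj₂ e))
  emptyˡ (inj₂ zero)    e = proper₁ L R bridge₁ (cong proj₁ e)
  emptyˡ (inj₁ (suc i)) e = proper₁ L _ (cl-left i) (cong proj₁ e)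
  emptyˡ (inj₂ (suc i)) e = proper₂ R _ (cl-right i) (cong proj₂ e)

  emptyʳ : ∀ v → (c₁ R , c₂ L) ≢ cellOf v
  emptyʳ (inj₁ zero)    e = proper₁ L R bridge₁ (sym (cong proj₁ e))
  emptyʳ (inj₂ zero)    e = proper₂ L R bridge₁ (cong proj₂ e)
  emptyʳ (inj₁ (suc i)) e = proper₂ L _ (cl-left i) (cong proj₂ e)
  emptyʳ (inj₂ (suc i)) e = proper₁ R _ (cl-right i) (cong proj₁ e)

  extended : Fin 2 ⊎ (Fin (suc k) ⊎ Fin (suc k)) → Cell c
  extended (inj₁ zero)       = c₁ L , c₂ R
  extended (inj₁ (suc zero)) = c₁ R , c₂ L
  extended (inj₂ v)          = cellOf v

  extended-injective : Injective _≡_ _≡_ extended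
  extended-injective {inj₁ zero}       {inj₁ zero}       _ = refl
  extended-injective {inj₁ zero}       {inj₁ (suc zero)} e = ⊥-elim (proper₁ L R bridge₁ (cong proj₁ e))
  extended-injective {inj₁ (suc zero)} {inj₁ zero}       e = ⊥-elim (proper₁ L R bridge₁ (sym (cong proj₁ e)))
  extended-injective {inj₁ (suc zero)} {inj₁ (suc zero)} _ = refl
  extended-injective {inj₁ zero}       {inj₂ v}          e = ⊥-elim (emptyˡ v e)
  extended-injective {inj₁ (suc zero)} {inj₂ v}          e = ⊥-elim (emptyʳ v e)
  extended-injective {inj₂ v}          {inj₁ zero}       e = ⊥-elim (emptyˡ v (sym e))
  extended-injective {inj₂ v}          {inj₁ (suc zero)} e = ⊥-elim (emptyʳ v (sym e))
  extended-injective {inj₂ u}          {inj₂ v}          e =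
    cong inj₂ (orthogonal u v (cong proj₁ e) (cong proj₂ e))

  domain≅ : (Fin 2 ⊎ (Fin (suc k) ⊎ Fin (suc k))) ↔ Fin (2 + (suc k + suc k))
  domain≅ = ↔-trans (↔-refl ⊎-↔ ↔-sym +↔⊎) (↔-sym +↔⊎)

  size : 2 + (suc k + suc k) ≡ 2 + 2 * suc k
  size = cong (λ n → 2 + (suc k + n)) (sym (+-identityʳ (suc k)))

map₂-inj₂ : ∀ {A B C : Set} {f : B → C} (z : A ⊎ B) {c : C} →
  map₂ f z ≡ inj₂ c → ∃[ b ] z ≡ inj₂ b × f b ≡ c
map₂-inj₂ (inj₂ b) refl = b , refl , refl

-- Packing: k items on each of two sides, with p private slots per side and s
-- shared slots, fit without collision whenever 2k ≤ 2p + s.  Both sides fill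
-- their private slots first; the first side then takes shared slots from the
-- front, the second side (via opposite) from the back.
module Packing (p s k : ℕ) (room : k + k ≤ (p + p) + s) where

  k≤p+s : k ≤ p + s
  k≤p+s = *-cancelˡ-≤ 2 (begin
    2 * k                ≡⟨ cong (k +_) (+-identityʳ k) ⟩
    k + k                ≤⟨ room ⟩
    (p + p) + s          ≤⟨ +-monoʳ-≤ (p + p) (m≤m+n s s) ⟩
    (p + p) + (s + s)    ≡⟨ regroup p s ⟩
    2 * (p + s)          ∎)
    where
    open ≤-Reasoning
    regroup : ∀ p s → (p + p) + (s + s) ≡ 2 * (p + s)
    regroup = solve-∀

  slot : Fin k → Fin p ⊎ Fin s
  slot i = splitAt p (inject≤ i k≤p+s)

  mirroredSlot : Fin k → Fin p ⊎ Fin s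
  mirroredSlot = map₂ opposite ∘ slot

  slot-injective : Injective _≡_ _≡_ slot
  slot-injective {i} {j} e = inject≤-injective k≤p+s k≤p+s i j (↔-injective (+↔⊎ {p} {s}) e)

  mirroredSlot-injective : Injective _≡_ _≡_ mirroredSlot
  mirroredSlot-injective = slot-injective ∘ ↔-injective (↔-refl ⊎-↔ opposite≅)
    where
    opposite≅ : Fin s ↔ Fin s
    opposite≅ = mk↔ₛ′ opposite opposite opposite-involutive opposite-involutive

  slot-shared : ∀ i {a} → slot i ≡ inj₂ a → toℕ i ≡ p + toℕ a
  slot-shared i {a} e = begin
    toℕ i                      ≡⟨ sym (toℕ-inject≤ i k≤p+s) ⟩
    toℕ (inject≤ i k≤p+s)      ≡⟨ cong toℕ (sym (splitAt⁻¹-↑ʳ e)) ⟩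
    toℕ (p ↑ʳ a)               ≡⟨ toℕ-↑ʳ p a ⟩
    p + toℕ a                  ∎
    where open ≡-Reasoning

  -- Shared slots a and opposite b are never both taken by the first side:
  -- that needs a + b + 1 = s, so the two items, at positions p + a and p + b
  -- below k, would satisfy 2k ≥ (p + a + 1) + (p + b + 1) = 2p + s + 1.
  shared-front-back : ∀ i j {a b} → slot i ≡ inj₂ a → slot j ≡ inj₂ b → a ≢ opposite b
  shared-front-back i j {a} {b} ea eb a≡b̄ = <-irrefl refl (begin-strict
    (p + p) + s                     ≡⟨ cong ((p + p) +_) (sym a+1+b≡s) ⟩
    (p + p) + (toℕ a + suc (toℕ b)) ≡⟨ rearrange p (toℕ a) (toℕ b) ⟩
    suc ((p + toℕ a) + (p + toℕ b)) ≡⟨ cong₂ (λ x y → suc (x + y))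
                                         (sym (slot-shared i ea)) (sym (slot-shared j eb)) ⟩
    suc (toℕ i + toℕ j)             <⟨ n<1+n _ ⟩
    suc (suc (toℕ i + toℕ j))       ≡⟨ cong suc (sym (+-suc (toℕ i) (toℕ j))) ⟩
    suc (toℕ i) + suc (toℕ j)       ≤⟨ +-mono-≤ (toℕ<n i) (toℕ<n j) ⟩
    k + k                           ≤⟨ room ⟩
    (p + p) + s                     ∎)
    where
    open ≤-Reasoning
    rearrange : ∀ p a b → (p + p) + (a + suc b) ≡ suc ((p + a) + (p + b))
    rearrange = solve-∀
    a+1+b≡s : toℕ a + suc (toℕ b) ≡ s
    a+1+b≡s = begin-equality
      toℕ a + suc (toℕ b)              ≡⟨ cong (_+ suc (toℕ b)) (cong toℕ a≡b̄) ⟩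
      toℕ (opposite b) + suc (toℕ b)   ≡⟨ cong (_+ suc (toℕ b)) (opposite-prop b) ⟩
      s ∸ suc (toℕ b) + suc (toℕ b)    ≡⟨ m∸n+n≡m (toℕ<n b) ⟩
      s                                ∎

  slots-disjoint : ∀ i j {a} → slot i ≡ inj₂ a → mirroredSlot j ≢ inj₂ a
  slots-disjoint i j ea e with map₂-inj₂ (slot j) e
  ... | b , eb , b̄≡a = shared-front-back i j ea eb (sym b̄≡a)

-- A side with colour c owns the private cells
-- (c, ↑ x) and (↑ x, c); the cells (↑ x, ↑ y) are shared.
module Placement (M : ℕ) where

  Colour : Set
  Colour = Fin (2 + M)

  ↑_ : Fin M → Colour
  ↑ x = suc (suc x)

  ↑-injective : ∀ {x y} → ↑ x ≡ ↑ y → x ≡ y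
  ↑-injective refl = refl

  0ᶜ 1ᶜ : Colour
  0ᶜ = zero
  1ᶜ = suc zero

  0≢1 : 0ᶜ ≢ 1ᶜ
  0≢1 ()

  Low : Colour → Set
  Low c = ∀ x → c ≢ ↑ x

  low₀ : Low 0ᶜ
  low₀ _ ()

  low₁ : Low 1ᶜ
  low₁ _ ()

  edge : Colour → Fin M ⊎ Fin M → Cell (2 + M)
  edge c (inj₁ x) = c , ↑ x
  edge c (inj₂ x) = ↑ x , c

  shared : Fin M × Fin M → Cell (2 + M)
  shared (x , y) = ↑ x , ↑ y

  place : Colour → Fin (M + M) ⊎ Fin (M * M) → Cell (2 + M)
  place c (inj₁ x) = edge c (splitAt M x)
  place c (inj₂ x) = shared (remQuot M x)

  shared-injective : Injective _≡_ _≡_ shared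
  shared-injective {_ , _} {_ , _} refl = refl

  edge≢shared : ∀ {c} → Low c → ∀ w t → edge c w ≢ shared t
  edge≢shared low (inj₁ _) (x , _) e = low x (cong proj₁ e)
  edge≢shared low (inj₂ _) (_ , y) e = low y (cong proj₂ e)

  edges-disjoint : ∀ {c c′} → Low c → Low c′ → c ≢ c′ → ∀ w w′ → edge c w ≢ edge c′ w′
  edges-disjoint low low′ c≢c′ (inj₁ _) (inj₁ _) e = c≢c′ (cong proj₁ e)
  edges-disjoint low low′ c≢c′ (inj₁ _) (inj₂ y) e = low y (cong proj₁ e)
  edges-disjoint low low′ c≢c′ (inj₂ x) (inj₁ _) e = low′ x (sym (cong proj₁ e))
  edges-disjoint low low′ c≢c′ (inj₂ _) (inj₂ _) e = c≢c′ (cong proj₂ e)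

  edge-injective : ∀ {c} → Low c → Injective _≡_ _≡_ (edge c)
  edge-injective low {inj₁ _} {inj₁ _} e = cong inj₁ (↑-injective (cong proj₂ e))
  edge-injective low {inj₁ _} {inj₂ y} e = ⊥-elim (low y (cong proj₁ e))
  edge-injective low {inj₂ x} {inj₁ _} e = ⊥-elim (low x (sym (cong proj₁ e)))
  edge-injective low {inj₂ _} {inj₂ _} e = cong inj₂ (↑-injective (cong proj₁ e))

  place-injective : ∀ {c} → Low c → Injective _≡_ _≡_ (place c)
  place-injective low {inj₁ _} {inj₁ _} e = cong inj₁ (↔-injective (+↔⊎ {M} {M}) (edge-injective low e))
  place-injective low {inj₁ _} {inj₂ _} e = ⊥-elim (edge≢shared low _ _ e)
  place-injective low {inj₂ _} {inj₁ _} e = ⊥-elim (edge≢shared low _ _ (sym e))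
  place-injective low {inj₂ _} {inj₂ _} e = cong inj₂ (↔-injective (*↔× {M} {M}) (shared-injective e))

  place-meet : ∀ {c c′} → Low c → Low c′ → c ≢ c′ → ∀ z z′ →
    place c z ≡ place c′ z′ → ∃[ a ] z ≡ inj₂ a × z′ ≡ inj₂ a
  place-meet low low′ c≢c′ (inj₁ _) (inj₁ _) e = ⊥-elim (edges-disjoint low low′ c≢c′ _ _ e)
  place-meet low low′ c≢c′ (inj₁ _) (inj₂ _) e = ⊥-elim (edge≢shared low _ _ e)
  place-meet low low′ c≢c′ (inj₂ _) (inj₁ _) e = ⊥-elim (edge≢shared low′ _ _ (sym e))
  place-meet low low′ c≢c′ (inj₂ x) (inj₂ _) e =
    x , refl , cong inj₂ (sym (↔-injective (*↔× {M} {M}) (shared-injective e)))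

  place-avoids : ∀ {c d} → Low d → d ≢ c → ∀ z → Separated (d , d) (place c z)
  place-avoids low d≢c (inj₁ x) with splitAt M x
  ... | inj₁ y = d≢c , low y
  ... | inj₂ y = low y , d≢c
  place-avoids low d≢c (inj₂ x) = low _ , low _

  place-offDiagonal : ∀ {c} → Low c → ∀ z → (c , c) ≢ place c z
  place-offDiagonal low (inj₁ x) with splitAt M x
  ... | inj₁ y = λ e → low y (cong proj₂ e)
  ... | inj₂ y = λ e → low y (cong proj₁ e)
  place-offDiagonal low (inj₂ x) e = low _ (cong proj₁ e)

module Construction (M k : ℕ) (room : k + k ≤ ((M + M) + (M + M)) + M * M) where
  open Packing (M + M) (M * M) k room
  open Placement M

  cell : Fin (suc k) ⊎ Fin (suc k) → Cell (2 + M)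
  cell (inj₁ zero)    = 0ᶜ , 0ᶜ
  cell (inj₂ zero)    = 1ᶜ , 1ᶜ
  cell (inj₁ (suc i)) = place 1ᶜ (slot i)
  cell (inj₂ (suc j)) = place 0ᶜ (mirroredSlot j)

  cell-separated : ∀ u v → DSAdj k u v → Separated (cell u) (cell v)
  cell-separated _ _ (cl-left i)  = place-avoids low₀ 0≢1 (slot i)
  cell-separated _ _ (lc-left i)  = Separated-sym (place-avoids low₀ 0≢1 (slot i))
  cell-separated _ _ (cl-right j) = place-avoids low₁ (0≢1 ∘ sym) (mirroredSlot j)
  cell-separated _ _ (lc-right j) = Separated-sym (place-avoids low₁ (0≢1 ∘ sym) (mirroredSlot j))
  cell-separated _ _ bridge₁      = (λ ()) , (λ ())
  cell-separated _ _ bridge₂      = (λ ()) , (λ ())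

  leaves-disjoint : ∀ i j → place 1ᶜ (slot i) ≢ place 0ᶜ (mirroredSlot j)
  leaves-disjoint i j e with place-meet low₁ low₀ (0≢1 ∘ sym) (slot i) (mirroredSlot j) e
  ... | _ , ea , eb = slots-disjoint i j ea eb

  L≢left : ∀ i → cell (inj₁ zero) ≢ cell (inj₁ (suc i))
  L≢left i = Separated⇒≢ (place-avoids low₀ 0≢1 (slot i))

  L≢right : ∀ j → cell (inj₁ zero) ≢ cell (inj₂ (suc j))
  L≢right j = place-offDiagonal low₀ (mirroredSlot j)

  R≢left : ∀ i → cell (inj₂ zero) ≢ cell (inj₁ (suc i))
  R≢left i = place-offDiagonal low₁ (slot i)

  R≢right : ∀ j → cell (inj₂ zero) ≢ cell (inj₂ (suc j))
  R≢right j = Separated⇒≢ (place-avoids low₁ (0≢1 ∘ sym) (mirroredSlot j))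

  cell-injective : Injective _≡_ _≡_ cell
  cell-injective {inj₁ zero}    {inj₁ zero}    _ = refl
  cell-injective {inj₁ zero}    {inj₂ zero}    ()
  cell-injective {inj₂ zero}    {inj₁ zero}    ()
  cell-injective {inj₂ zero}    {inj₂ zero}    _ = refl
  cell-injective {inj₁ zero}    {inj₁ (suc j)} e = ⊥-elim (L≢left j e)
  cell-injective {inj₁ zero}    {inj₂ (suc j)} e = ⊥-elim (L≢right j e)
  cell-injective {inj₂ zero}    {inj₁ (suc j)} e = ⊥-elim (R≢left j e)
  cell-injective {inj₂ zero}    {inj₂ (suc j)} e = ⊥-elim (R≢right j e)
  cell-injective {inj₁ (suc i)} {inj₁ zero}    e = ⊥-elim (L≢left i (sym e))
  cell-injective {inj₂ (suc i)} {inj₁ zero}    e = ⊥-elim (L≢right i (sym e))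
  cell-injective {inj₁ (suc i)} {inj₂ zero}    e = ⊥-elim (R≢left i (sym e))
  cell-injective {inj₂ (suc i)} {inj₂ zero}    e = ⊥-elim (R≢right i (sym e))
  cell-injective {inj₁ (suc i)} {inj₁ (suc j)} e =
    cong (inj₁ ∘ suc) (slot-injective (place-injective low₁ e))
  cell-injective {inj₂ (suc i)} {inj₂ (suc j)} e =
    cong (inj₂ ∘ suc) (mirroredSlot-injective (place-injective low₀ e))
  cell-injective {inj₁ (suc i)} {inj₂ (suc j)} e = ⊥-elim (leaves-disjoint i j e)
  cell-injective {inj₂ (suc i)} {inj₁ (suc j)} e = ⊥-elim (leaves-disjoint j i (sym e))

  colouring : HasOrthPair (DoubleStar k) (2 + M)
  colouring = placement⇒orthogonalPair (DoubleStar k) cell cell-injective cell-separated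

room⇒orthogonalPair : ∀ k N → 2 + 2 * suc k ≤ N * N → HasOrthPair (DoubleStar k) N
room⇒orthogonalPair k zero ()
room⇒orthogonalPair k (suc zero) (s≤s ())
room⇒orthogonalPair k (suc (suc M)) bound =
  Construction.colouring M k (+-cancelˡ-≤ 4 _ _ (subst₂ _≤_ (lhs k) (rhs M) bound))
  where
  lhs : ∀ k → 2 + 2 * suc k ≡ 4 + (k + k)
  lhs = solve-∀
  rhs : ∀ M → (2 + M) * (2 + M) ≡ 4 + (((M + M) + (M + M)) + M * M)
  rhs = solve-∀

<∸1⇔2+≤ : ∀ m n → m < n ∸ 1 ⇔ 2 + m ≤ n
<∸1⇔2+≤ m zero    = mk⇔ (λ ()) (λ ())
<∸1⇔2+≤ m (suc n) = mk⇔ s≤s s≤s⁻¹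

theorem4 : (m k N : ℕ) → m ≡ 2 * suc k → IsCeilSqrt m N →
    OChiIs (DoubleStar k) N ⇔ m < N * N ∸ 1
theorem4 m k N refl (_ , least) = mk⇔ necessary sufficient
  where
  condition : m < N * N ∸ 1 ⇔ 2 + m ≤ N * N
  condition = <∸1⇔2+≤ m (N * N)

  necessary : OChiIs (DoubleStar k) N → m < N * N ∸ 1
  necessary (pair , _) = Equivalence.from condition (orthogonalPair⇒room pair)

  minimal : ∀ c → HasOrthPair (DoubleStar k) c → N ≤ c
  minimal c pair = least c (≤-trans (m≤n+m m 2) (orthogonalPair⇒room pair))

  sufficient : m < N * N ∸ 1 → OChiIs (DoubleStar k) N
  sufficient lt = room⇒orthogonalPair k N (Equivalence.to condition lt) , minimal
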